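{- Let $G$ be a graph and let $A\subseteq V(G)$ be a clique of $G$. Then \[ I((G,A)\circ 2K_{1};x)=(1+x)^{2|A|-2}\cdot I((G,A)+2K_{1};x). \]
   Context: All graphs are finite and simple. For a graph $G$, $I(G;x)=\sum_{k\ge0}s_kx^k$ where $s_k$ is the number of independent sets (sets of pairwise non-adjacent vertices) of size $k$. $2K_1$ is the graph with two non-adjacent vertices. $(G,A)\circ 2K_1$ is obtained from $G$ by adding, for each vertex $a\in A$, two new non-adjacent vertices joined only to $a$. $(G,A)+2K_1$ is obtained from $G$ by adding two new non-adjacent vertices, each joined to every vertex of $A$ (and to nothing else). -}

module Defs where

open import Data.Nat using (ℕ; zero; suc; _+_; _*_; _∸_)
open import Data.Nat.Combinatorics using (_C_)
open import Data.Bool using (Bool; true; false; if_then_else_; _∧_; not)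
open import Data.List using (List; []; _∷_; _++_; map; length; filter; upTo; concatMap; allFin)
open import Data.Nat.ListAction using (sum)
open import Data.Bool.ListAction using (all)
open import Data.Fin using (Fin)
open import Data.Fin.Properties using (_≟_)
open import Data.Bool.Properties renaming (_≟_ to _≟ᵇ_) using ()
open import Data.Sum using (_⊎_; inj₁; inj₂)
open import Data.Product using (_×_; _,_)
open import Relation.Nullary.Decidable using (does; ⌊_⌋)
open import Relation.Binary.PropositionalEquality using (_≡_; _≢_)

record Graph (n : ℕ) : Set where
  field
    adj   : Fin n → Fin n → Bool
    sym   : ∀ u v → adj u v ≡ adj v u
    irrefl : ∀ v → adj v v ≡ false

VSet : ℕ → Set
VSet n = Fin n → Bool

card : ∀ {n} → VSet n → ℕ
card {n} A = length (filter (λ v → A v ≟ᵇ true) (allFin n))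

IsClique : ∀ {n} → Graph n → VSet n → Set
IsClique {n} G A = ∀ (u v : Fin n) → A u ≡ true → A v ≡ true → u ≢ v → Graph.adj G u v ≡ true

-- Independence polynomial of a graph presented by an explicit
-- duplicate-free vertex list and a Bool adjacency relation.

choose : ∀ {V : Set} → ℕ → List V → List (List V)
choose zero    _        = [] ∷ []
choose (suc k) []       = []
choose (suc k) (x ∷ xs) = map (x ∷_) (choose k xs) ++ choose (suc k) xs

indep : ∀ {V : Set} → (V → V → Bool) → List V → Bool
indep adj []       = true
indep adj (x ∷ xs) = all (λ y → not (adj x y)) xs ∧ indep adj xs

Poly : Set
Poly = ℕ → ℕ

indPoly : ∀ {V : Set} → List V → (V → V → Bool) → Poly
indPoly vs adj k = length (filter (λ S → indep adj S ≟ᵇ true) (choose k vs))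

infixl 7 _⊛_
infixr 8 _^ᵖ_

_⊛_ : Poly → Poly → Poly
(p ⊛ q) k = sum (map (λ i → p i * q (k ∸ i)) (upTo (suc k)))

onePoly : Poly
onePoly zero    = 1
onePoly (suc _) = 0

onePlusX : Poly
onePlusX zero          = 1
onePlusX (suc zero)    = 1
onePlusX (suc (suc _)) = 0

_^ᵖ_ : Poly → ℕ → Poly
p ^ᵖ zero  = onePoly
p ^ᵖ suc m = p ⊛ (p ^ᵖ m)

I : ∀ {n} → Graph n → Poly
I {n} G = indPoly (allFin n) (Graph.adj G)

-- (G,A) ∘ 2K₁ : vertices inj₁ v (v ∈ V(G)) and inj₂ (a , b) for a ∈ A, b ∈ Bool
coronaVerts : ∀ {n} → VSet n → List (Fin n ⊎ (Fin n × Bool))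
coronaVerts {n} A =
  map inj₁ (allFin n) ++
  concatMap (λ a → if A a then inj₂ (a , false) ∷ inj₂ (a , true) ∷ [] else []) (allFin n)

coronaAdj : ∀ {n} → Graph n → Fin n ⊎ (Fin n × Bool) → Fin n ⊎ (Fin n × Bool) → Bool
coronaAdj G (inj₁ u)       (inj₁ v)       = Graph.adj G u v
coronaAdj G (inj₁ u)       (inj₂ (a , _)) = does (u ≟ a)
coronaAdj G (inj₂ (a , _)) (inj₁ u)       = does (u ≟ a)
coronaAdj G (inj₂ _)       (inj₂ _)       = false

Icorona : ∀ {n} → Graph n → VSet n → Poly
Icorona G A = indPoly (coronaVerts A) (coronaAdj G)

-- (G,A) + 2K₁ : vertices inj₁ v (v ∈ V(G)) and two new vertices inj₂ false, inj₂ true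
plusVerts : ∀ {n} → List (Fin n ⊎ Bool)
plusVerts {n} = map inj₁ (allFin n) ++ inj₂ false ∷ inj₂ true ∷ []

plusAdj : ∀ {n} → Graph n → VSet n → Fin n ⊎ Bool → Fin n ⊎ Bool → Bool
plusAdj G A (inj₁ u) (inj₁ v) = Graph.adj G u v
plusAdj G A (inj₁ u) (inj₂ _) = A u
plusAdj G A (inj₂ _) (inj₁ u) = A u
plusAdj G A (inj₂ _) (inj₂ _) = false

Iplus : ∀ {n} → Graph n → VSet n → Poly
Iplus {n} G A = indPoly (plusVerts {n}) (plusAdj G A)

module Submission where

-- Both graphs consist of a copy of G followed by extra, pairwise non-adjacent vertices:
-- two pendants for every a ∈ A in the corona, two new vertices joined to A in the sum.
-- We evaluate independence polynomials by the deletion recurrence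
-- I(H) = I(H − v) + x · I(H − N[v]) applied to the vertices of G first (indRec), so that
-- both polynomials become the same sum over independent sets S of G, and compare the
-- contributions of the extra vertices for each S.  Pairwise non-adjacent extra vertices
-- contribute (1 + x)^(number still allowed).  Since A is a clique, S meets A in at most
-- one vertex: if S ∩ A = ∅ the corona has 2|A| free pendants and the sum 2 free vertices,
-- if S ∩ A = {a₀} the corona has 2|A| − 2 and the sum none.  Either way the ratio is
-- (1 + x)^(2|A| − 2).

open import Defs
open import Data.Nat using (ℕ; zero; suc; _+_; _*_; _∸_; _≤_; s≤s; z≤n)
open import Data.Nat.Properties using (+-suc; +-comm; +-identityʳ; *-distribʳ-+; m+n∸m≡n)
open import Data.Nat.Tactic.RingSolver using (solve-∀)
open import Data.Nat.ListAction using (sum)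
open import Data.Bool using (Bool; true; false; if_then_else_; _∧_; not)
open import Data.Bool.Properties using (∧-comm; ∧-assoc; ∧-zeroʳ; ∧-identityʳ; if-float) renaming (_≟_ to _≟ᵇ_)
open import Data.Bool.ListAction using (all)
open import Data.List using (List; []; _∷_; _++_; map; length; filter; concatMap; tabulate; allFin; applyUpTo)
open import Data.List.Properties using (length-++; filter-++; map-tabulate; map-concatMap; concatMap-cong)
open import Data.Fin using (Fin)
import Data.Fin as Fin
open import Data.Fin.Properties using (_≟_)
open import Data.Sum using (_⊎_; inj₁; inj₂)
open import Data.Product using (_×_; _,_)
open import Relation.Binary.PropositionalEquality using (_≡_; _≢_; _≗_; refl; sym; trans; cong; cong₂; module ≡-Reasoning)
open import Relation.Nullary.Decidable using (does; yes; no; dec-false)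
open import Relation.Nullary using (contradiction)

count : ∀ {V : Set} → (V → Bool) → List V → ℕ
count p L = length (filter (λ v → p v ≟ᵇ true) L)

count-++ : ∀ {V : Set} (p : V → Bool) (L M : List V) → count p (L ++ M) ≡ count p L + count p M
count-++ p L M = trans (cong length (filter-++ (λ v → p v ≟ᵇ true) L M)) (length-++ (filter _ L))

count-map : ∀ {V W : Set} (p : W → Bool) (f : V → W) (L : List V) → count p (map f L) ≡ count (λ v → p (f v)) L
count-map p f [] = refl
count-map p f (x ∷ L) with p (f x)
... | true  = cong suc (count-map p f L)
... | false = count-map p f L

count-cong : ∀ {V : Set} {p q : V → Bool} → (∀ v → p v ≡ q v) → (L : List V) → count p L ≡ count q L
count-cong e [] = refl
count-cong {q = q} e (x ∷ L) rewrite e x with q x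
... | true  = cong suc (count-cong e L)
... | false = count-cong e L

count-singleton : ∀ {V : Set} (p : V → Bool) x → count p (x ∷ []) ≡ (if p x then 1 else 0)
count-singleton p x with p x
... | true  = refl
... | false = refl

count-allFin-suc : ∀ {n} (p : Fin (suc n) → Bool) →
  count p (allFin (suc n)) ≡ (if p Fin.zero then 1 else 0) + count (λ a → p (Fin.suc a)) (allFin n)
count-allFin-suc {n} p = begin
  count p (Fin.zero ∷ tabulate Fin.suc)                              ≡⟨ cong (λ L → count p (Fin.zero ∷ L)) (sym (map-tabulate (λ i → i) Fin.suc)) ⟩
  count p ((Fin.zero ∷ []) ++ map Fin.suc (allFin n))                ≡⟨ count-++ p (Fin.zero ∷ []) (map Fin.suc (allFin n)) ⟩
  count p (Fin.zero ∷ []) + count p (map Fin.suc (allFin n))         ≡⟨ cong₂ _+_ (count-singleton p Fin.zero) (count-map p Fin.suc (allFin n)) ⟩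
  (if p Fin.zero then 1 else 0) + count (λ a → p (Fin.suc a)) (allFin n) ∎
  where open ≡-Reasoning

count-remove : ∀ {n} (p : Fin n → Bool) (a₀ : Fin n) → p a₀ ≡ true →
  count p (allFin n) ≡ suc (count (λ a → not (does (a₀ ≟ a)) ∧ p a) (allFin n))
count-remove {suc n} p Fin.zero pa₀ = begin
  count p (allFin (suc n))                        ≡⟨ count-allFin-suc p ⟩
  (if p Fin.zero then 1 else 0) + count (λ a → p (Fin.suc a)) (allFin n) ≡⟨ cong (λ b → (if b then 1 else 0) + count (λ a → p (Fin.suc a)) (allFin n)) pa₀ ⟩
  suc (count (λ a → p (Fin.suc a)) (allFin n))    ≡⟨ cong suc (sym (count-allFin-suc (λ a → not (does (Fin.zero ≟ a)) ∧ p a))) ⟩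
  suc (count (λ a → not (does (Fin.zero ≟ a)) ∧ p a) (allFin (suc n))) ∎
  where open ≡-Reasoning
count-remove {suc n} p (Fin.suc b) pa₀ = begin
  count p (allFin (suc n))                        ≡⟨ count-allFin-suc p ⟩
  c + count (λ a → p (Fin.suc a)) (allFin n)      ≡⟨ cong (c +_) (count-remove (λ a → p (Fin.suc a)) b pa₀) ⟩
  c + suc (count q (allFin n))                    ≡⟨ +-suc c _ ⟩
  suc (c + count q (allFin n))                    ≡⟨ cong suc (sym (count-allFin-suc (λ a → not (does (Fin.suc b ≟ a)) ∧ p a))) ⟩
  suc (count (λ a → not (does (Fin.suc b ≟ a)) ∧ p a) (allFin (suc n))) ∎
  where
  open ≡-Reasoning
  c : ℕ
  c = if p Fin.zero then 1 else 0
  q : Fin n → Bool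
  q = λ a → not (does (b ≟ a)) ∧ p (Fin.suc a)

shiftX : Poly → Poly
shiftX p zero    = 0
shiftX p (suc k) = p k

infixl 6 _⊕_
_⊕_ : Poly → Poly → Poly
(p ⊕ q) k = p k + q k

mul1+x : Poly → Poly
mul1+x p = p ⊕ shiftX p

mul1+x^ : ℕ → Poly → Poly
mul1+x^ zero    p = p
mul1+x^ (suc m) p = mul1+x (mul1+x^ m p)

map-applyUpTo : ∀ {A : Set} (f : ℕ → A) (g : ℕ → ℕ) n → map f (applyUpTo g n) ≡ applyUpTo (λ i → f (g i)) n
map-applyUpTo f g zero    = refl
map-applyUpTo f g (suc n) = cong (f (g 0) ∷_) (map-applyUpTo f (λ i → g (suc i)) n)

⊛-zero : ∀ p q → (p ⊛ q) 0 ≡ p 0 * q 0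
⊛-zero p q = +-identityʳ (p 0 * q 0)

⊛-suc : ∀ p q k → (p ⊛ q) (suc k) ≡ p 0 * q (suc k) + ((λ i → p (suc i)) ⊛ q) k
⊛-suc p q k = cong (λ L → p 0 * q (suc k) + sum L)
  (trans (map-applyUpTo (λ i → p i * q (suc k ∸ i)) suc (suc k))
         (sym (map-applyUpTo (λ i → p (suc i) * q (k ∸ i)) (λ i → i) (suc k))))

⊛-congˡ : ∀ {p p′} q → p ≗ p′ → (p ⊛ q) ≗ (p′ ⊛ q)
⊛-congˡ {p} {p′} q e zero = cong (λ a → a * q 0 + 0) (e 0)
⊛-congˡ {p} {p′} q e (suc k) = begin
  (p ⊛ q) (suc k)                                 ≡⟨ ⊛-suc p q k ⟩
  p 0 * q (suc k) + ((λ i → p (suc i)) ⊛ q) k     ≡⟨ cong₂ (λ a b → a * q (suc k) + b) (e 0) (⊛-congˡ q (λ i → e (suc i)) k) ⟩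
  p′ 0 * q (suc k) + ((λ i → p′ (suc i)) ⊛ q) k   ≡⟨ sym (⊛-suc p′ q k) ⟩
  (p′ ⊛ q) (suc k) ∎
  where open ≡-Reasoning

⊛-distribʳ-⊕ : ∀ p p′ q → ((p ⊕ p′) ⊛ q) ≗ ((p ⊛ q) ⊕ (p′ ⊛ q))
⊛-distribʳ-⊕ p p′ q zero = begin
  (p 0 + p′ 0) * q 0 + 0       ≡⟨ +-identityʳ _ ⟩
  (p 0 + p′ 0) * q 0           ≡⟨ *-distribʳ-+ (q 0) (p 0) (p′ 0) ⟩
  p 0 * q 0 + p′ 0 * q 0       ≡⟨ sym (cong₂ _+_ (⊛-zero p q) (⊛-zero p′ q)) ⟩
  (p ⊛ q) 0 + (p′ ⊛ q) 0 ∎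
  where open ≡-Reasoning
⊛-distribʳ-⊕ p p′ q (suc k) = begin
  ((p ⊕ p′) ⊛ q) (suc k)                                          ≡⟨ ⊛-suc (p ⊕ p′) q k ⟩
  (p 0 + p′ 0) * q (suc k) + ((λ i → p (suc i) + p′ (suc i)) ⊛ q) k ≡⟨ cong ((p 0 + p′ 0) * q (suc k) +_) (⊛-distribʳ-⊕ (λ i → p (suc i)) (λ i → p′ (suc i)) q k) ⟩
  (p 0 + p′ 0) * q (suc k) + (r k + r′ k)                          ≡⟨ shuffle (p 0) (p′ 0) (q (suc k)) (r k) (r′ k) ⟩
  (p 0 * q (suc k) + r k) + (p′ 0 * q (suc k) + r′ k)              ≡⟨ sym (cong₂ _+_ (⊛-suc p q k) (⊛-suc p′ q k)) ⟩
  (p ⊛ q) (suc k) + (p′ ⊛ q) (suc k) ∎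
  where
  open ≡-Reasoning
  r r′ : Poly
  r  = (λ i → p (suc i)) ⊛ q
  r′ = (λ i → p′ (suc i)) ⊛ q
  shuffle : ∀ a b c x y → (a + b) * c + (x + y) ≡ (a * c + x) + (b * c + y)
  shuffle = solve-∀

shiftX-⊛ : ∀ p q → (shiftX p ⊛ q) ≗ shiftX (p ⊛ q)
shiftX-⊛ p q zero    = refl
shiftX-⊛ p q (suc k) = ⊛-suc (shiftX p) q k

⊛-zeroˡ : ∀ q → ((λ _ → 0) ⊛ q) ≗ (λ _ → 0)
⊛-zeroˡ q zero    = refl
⊛-zeroˡ q (suc k) = trans (⊛-suc (λ _ → 0) q k) (⊛-zeroˡ q k)

⊛-identityˡ : ∀ q → (onePoly ⊛ q) ≗ q
⊛-identityˡ q zero    = trans (+-identityʳ (q 0 + 0)) (+-identityʳ (q 0))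
⊛-identityˡ q (suc k) = begin
  (onePoly ⊛ q) (suc k)                          ≡⟨ ⊛-suc onePoly q k ⟩
  (q (suc k) + 0) + ((λ _ → 0) ⊛ q) k            ≡⟨ cong₂ _+_ (+-identityʳ (q (suc k))) (⊛-zeroˡ q k) ⟩
  q (suc k) + 0                                   ≡⟨ +-identityʳ (q (suc k)) ⟩
  q (suc k) ∎
  where open ≡-Reasoning

shiftX-cong : ∀ {p q} → p ≗ q → shiftX p ≗ shiftX q
shiftX-cong e zero    = refl
shiftX-cong e (suc k) = e k

mul1+x-cong : ∀ {p q} → p ≗ q → mul1+x p ≗ mul1+x q
mul1+x-cong e zero    = cong (_+ 0) (e 0)
mul1+x-cong e (suc k) = cong₂ _+_ (e (suc k)) (e k)

mul1+x-⊛ : ∀ p q → (mul1+x p ⊛ q) ≗ mul1+x (p ⊛ q)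
mul1+x-⊛ p q k = trans (⊛-distribʳ-⊕ p (shiftX p) q k) (cong ((p ⊛ q) k +_) (shiftX-⊛ p q k))

onePlusX≗ : onePlusX ≗ mul1+x onePoly
onePlusX≗ zero          = refl
onePlusX≗ (suc zero)    = refl
onePlusX≗ (suc (suc k)) = refl

onePlusX^-⊛ : ∀ m q → (onePlusX ^ᵖ m ⊛ q) ≗ mul1+x^ m q
onePlusX^-⊛ zero    q = ⊛-identityˡ q
onePlusX^-⊛ (suc m) q k = begin
  ((onePlusX ⊛ onePlusX ^ᵖ m) ⊛ q) k      ≡⟨ ⊛-congˡ q (λ j → trans (⊛-congˡ (onePlusX ^ᵖ m) onePlusX≗ j) (mul1+x-⊛ onePoly (onePlusX ^ᵖ m) j)) k ⟩
  (mul1+x (onePoly ⊛ onePlusX ^ᵖ m) ⊛ q) k ≡⟨ ⊛-congˡ q (mul1+x-cong (⊛-identityˡ (onePlusX ^ᵖ m))) k ⟩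
  (mul1+x (onePlusX ^ᵖ m) ⊛ q) k           ≡⟨ mul1+x-⊛ (onePlusX ^ᵖ m) q k ⟩
  mul1+x (onePlusX ^ᵖ m ⊛ q) k             ≡⟨ mul1+x-cong (onePlusX^-⊛ m q) k ⟩
  mul1+x^ (suc m) q k ∎
  where open ≡-Reasoning

mul1+x-⊕ : ∀ p q → mul1+x (p ⊕ q) ≗ (mul1+x p ⊕ mul1+x q)
mul1+x-⊕ p q zero    = shuffle (p 0) (q 0)
  where
  shuffle : ∀ a b → (a + b) + 0 ≡ (a + 0) + (b + 0)
  shuffle = solve-∀
mul1+x-⊕ p q (suc k) = shuffle (p (suc k)) (q (suc k)) (p k) (q k)
  where
  shuffle : ∀ a b c d → (a + b) + (c + d) ≡ (a + c) + (b + d)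
  shuffle = solve-∀

mul1+x-shiftX : ∀ p → mul1+x (shiftX p) ≗ shiftX (mul1+x p)
mul1+x-shiftX p zero    = refl
mul1+x-shiftX p (suc k) = refl

mul1+x^-cong : ∀ m {p q} → p ≗ q → mul1+x^ m p ≗ mul1+x^ m q
mul1+x^-cong zero    e = e
mul1+x^-cong (suc m) e = mul1+x-cong (mul1+x^-cong m e)

mul1+x^-⊕ : ∀ m p q → mul1+x^ m (p ⊕ q) ≗ (mul1+x^ m p ⊕ mul1+x^ m q)
mul1+x^-⊕ zero    p q k = refl
mul1+x^-⊕ (suc m) p q k = trans (mul1+x-cong (mul1+x^-⊕ m p q) k) (mul1+x-⊕ (mul1+x^ m p) (mul1+x^ m q) k)

mul1+x^-shiftX : ∀ m p → mul1+x^ m (shiftX p) ≗ shiftX (mul1+x^ m p)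
mul1+x^-shiftX zero    p k = refl
mul1+x^-shiftX (suc m) p k = trans (mul1+x-cong (mul1+x^-shiftX m p) k) (mul1+x-shiftX (mul1+x^ m p) k)

mul1+x^-+ : ∀ a b p → mul1+x^ (a + b) p ≡ mul1+x^ a (mul1+x^ b p)
mul1+x^-+ zero    b p = refl
mul1+x^-+ (suc a) b p = cong mul1+x (mul1+x^-+ a b p)

-- I(H[ok];x) for the subgraph of the graph (vs, adj) induced by the vertices passing ok,
-- computed by the deletion recurrence I(H) = I(H − v) + x · I(H − N[v])
indRec : ∀ {V : Set} → (V → V → Bool) → List V → (V → Bool) → Poly
indRec adj []       ok = onePoly
indRec adj (v ∷ vs) ok =
  if ok v then indRec adj vs ok ⊕ shiftX (indRec adj vs (λ u → ok u ∧ not (adj v u)))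
  else indRec adj vs ok

indRec-zero : ∀ {V : Set} (adj : V → V → Bool) vs ok → indRec adj vs ok 0 ≡ 1
indRec-zero adj []       ok = refl
indRec-zero adj (v ∷ vs) ok with ok v
... | true  = trans (+-identityʳ _) (indRec-zero adj vs ok)
... | false = indRec-zero adj vs ok

count-false : ∀ {V : Set} (L : List V) → count (λ _ → false) L ≡ 0
count-false []      = refl
count-false (_ ∷ L) = count-false L

all-∧ : ∀ {V : Set} (f g : V → Bool) S → all (λ u → f u ∧ g u) S ≡ all f S ∧ all g S
all-∧ f g []      = refl
all-∧ f g (u ∷ S) rewrite all-∧ f g S with f u | g u
... | true  | true  = refl
... | true  | false = sym (∧-zeroʳ (all f S))
... | false | _     = refl

indep-cons : ∀ {V : Set} (adj : V → V → Bool) ok v → ok v ≡ true → (S : List V) →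
  (indep adj (v ∷ S) ∧ all ok (v ∷ S)) ≡ (indep adj S ∧ all (λ u → ok u ∧ not (adj v u)) S)
indep-cons adj ok v okv S rewrite okv = begin
  (a ∧ b) ∧ c  ≡⟨ cong (_∧ c) (∧-comm a b) ⟩
  (b ∧ a) ∧ c  ≡⟨ ∧-assoc b a c ⟩
  b ∧ (a ∧ c)  ≡⟨ cong (b ∧_) (∧-comm a c) ⟩
  b ∧ (c ∧ a)  ≡⟨ cong (b ∧_) (sym (all-∧ ok (λ u → not (adj v u)) S)) ⟩
  indep adj S ∧ all (λ u → ok u ∧ not (adj v u)) S ∎
  where
  open ≡-Reasoning
  a b c : Bool
  a = all (λ u → not (adj v u)) S
  b = indep adj S
  c = all ok S

count-choose : ∀ {V : Set} (adj : V → V → Bool) vs ok k →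
  count (λ S → indep adj S ∧ all ok S) (choose k vs) ≡ indRec adj vs ok k
count-choose adj []       ok zero    = refl
count-choose adj []       ok (suc k) = refl
count-choose adj (v ∷ vs) ok zero    = sym (indRec-zero adj (v ∷ vs) ok)
count-choose {V} adj (v ∷ vs) ok (suc k) with ok v in okv
... | true = begin
  count P (map (v ∷_) (choose k vs) ++ choose (suc k) vs)   ≡⟨ count-++ P (map (v ∷_) (choose k vs)) (choose (suc k) vs) ⟩
  count P (map (v ∷_) (choose k vs)) + count P (choose (suc k) vs)
    ≡⟨ cong₂ _+_ (trans (count-map P (v ∷_) (choose k vs)) (count-cong (indep-cons adj ok v okv) (choose k vs)))
                 (count-choose adj vs ok (suc k)) ⟩
  count (λ S → indep adj S ∧ all ok′ S) (choose k vs) + indRec adj vs ok (suc k)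
    ≡⟨ cong (_+ indRec adj vs ok (suc k)) (count-choose adj vs ok′ k) ⟩
  indRec adj vs ok′ k + indRec adj vs ok (suc k)              ≡⟨ +-comm (indRec adj vs ok′ k) _ ⟩
  indRec adj vs ok (suc k) + indRec adj vs ok′ k ∎
  where
  open ≡-Reasoning
  P : List V → Bool
  P = λ S → indep adj S ∧ all ok S
  ok′ : V → Bool
  ok′ = λ u → ok u ∧ not (adj v u)
... | false = begin
  count P (map (v ∷_) (choose k vs) ++ choose (suc k) vs)   ≡⟨ count-++ P (map (v ∷_) (choose k vs)) (choose (suc k) vs) ⟩
  count P (map (v ∷_) (choose k vs)) + count P (choose (suc k) vs)
    ≡⟨ cong₂ _+_ (trans (count-map P (v ∷_) (choose k vs))
                        (trans (count-cong rejected (choose k vs)) (count-false (choose k vs))))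
                 (count-choose adj vs ok (suc k)) ⟩
  indRec adj vs ok (suc k) ∎
  where
  open ≡-Reasoning
  P : List V → Bool
  P = λ S → indep adj S ∧ all ok S
  rejected : ∀ S → P (v ∷ S) ≡ false
  rejected S rewrite okv = ∧-zeroʳ (indep adj (v ∷ S))

all-true : ∀ {V : Set} (S : List V) → all (λ _ → true) S ≡ true
all-true []      = refl
all-true (_ ∷ S) = all-true S

indPoly≗indRec : ∀ {V : Set} (vs : List V) adj → indPoly vs adj ≗ indRec adj vs (λ _ → true)
indPoly≗indRec vs adj k =
  trans (count-cong (λ S → sym (trans (cong (indep adj S ∧_) (all-true S)) (∧-identityʳ (indep adj S)))) (choose k vs))
        (count-choose adj vs (λ _ → true) k)

indRec-independent : ∀ {V W : Set} (adj : V → V → Bool) (f : W → V) →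
  (∀ u w → adj (f u) (f w) ≡ false) →
  ∀ us ok → indRec adj (map f us) ok ≗ mul1+x^ (count (λ w → ok (f w)) us) onePoly
indRec-independent adj f nonadj []       ok k = refl
indRec-independent {V} adj f nonadj (u ∷ us) ok k with ok (f u)
... | false = indRec-independent adj f nonadj us ok k
... | true  = cong₂ _+_ (indRec-independent adj f nonadj us ok k)
                        (shiftX-cong (λ j → trans (indRec-independent adj f nonadj us ok′ j)
                                                   (cong (λ c → mul1+x^ c onePoly j) avoid)) k)
  where
  ok′ : V → Bool
  ok′ = λ y → ok y ∧ not (adj (f u) y)
  avoid : count (λ w → ok′ (f w)) us ≡ count (λ w → ok (f w)) us
  avoid = count-cong (λ w → trans (cong (λ b → ok (f w) ∧ not b) (nonadj u w)) (∧-identityʳ (ok (f w)))) us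

-- If a relation Inv between allowed-vertex predicates makes both
-- predicates agree on the core, survives deleting the closed neighbourhood of an
-- allowed core vertex in both graphs, and makes the tails differ by (1 + x)^e,
-- then the whole polynomials differ by (1 + x)^e: the deletion recurrence runs in
-- lock-step on the core, and multiplication by (1 + x)^e commutes with it.
module Simulation
  {X Vc Vp : Set} (adjc : Vc → Vc → Bool) (adjp : Vp → Vp → Bool)
  (ιc : X → Vc) (ιp : X → Vp) (Rc : List Vc) (Rp : List Vp) (e : ℕ)
  (Inv : (Vc → Bool) → (Vp → Bool) → Set)
  (agree : ∀ {oc op} → Inv oc op → ∀ x → oc (ιc x) ≡ op (ιp x))
  (step : ∀ {oc op} x → Inv oc op → oc (ιc x) ≡ true →
          Inv (λ y → oc y ∧ not (adjc (ιc x) y)) (λ y → op y ∧ not (adjp (ιp x) y)))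
  (base : ∀ {oc op} → Inv oc op → indRec adjc Rc oc ≗ mul1+x^ e (indRec adjp Rp op))
  where

  simulate : ∀ l {oc op} → Inv oc op →
    indRec adjc (map ιc l ++ Rc) oc ≗ mul1+x^ e (indRec adjp (map ιp l ++ Rp) op)
  simulate []      inv = base inv
  simulate (x ∷ l) {oc} {op} inv k rewrite sym (agree inv x) with oc (ιc x) in okx
  ... | false = simulate l inv k
  ... | true  = begin
    Pc k + shiftX Qc k                             ≡⟨ cong₂ _+_ (simulate l inv k) (shiftX-cong (simulate l (step x inv okx)) k) ⟩
    mul1+x^ e Pp k + shiftX (mul1+x^ e Qp) k       ≡⟨ cong (mul1+x^ e Pp k +_) (sym (mul1+x^-shiftX e Qp k)) ⟩
    mul1+x^ e Pp k + mul1+x^ e (shiftX Qp) k       ≡⟨ sym (mul1+x^-⊕ e Pp (shiftX Qp) k) ⟩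
    mul1+x^ e (Pp ⊕ shiftX Qp) k ∎
    where
    open ≡-Reasoning
    Pc Qc : Poly
    Pp Qp : Poly
    Pc = indRec adjc (map ιc l ++ Rc) oc
    Qc = indRec adjc (map ιc l ++ Rc) (λ y → oc y ∧ not (adjc (ιc x) y))
    Pp = indRec adjp (map ιp l ++ Rp) op
    Qp = indRec adjp (map ιp l ++ Rp) (λ y → op y ∧ not (adjp (ιp x) y))

halve : ∀ c → 2 * suc c ∸ 2 ≡ c + c
halve c = trans (cong (_∸ 2) (expand c)) (m+n∸m≡n 2 (c + c))
  where
  expand : ∀ c → 2 * suc c ≡ 2 + (c + c)
  expand = solve-∀

twice-pos : ∀ c → 1 ≤ c → c + c ≡ (2 * c ∸ 2) + 2
twice-pos (suc c) (s≤s z≤n) = trans (shift c) (cong (_+ 2) (sym (halve c)))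
  where
  shift : ∀ c → suc c + suc c ≡ (c + c) + 2
  shift = solve-∀

module CoronaVersusSum {n : ℕ} (G : Graph n) (A : VSet n) (clique : IsClique G A) where

  Vc Vp : Set
  Vc = Fin n ⊎ (Fin n × Bool)
  Vp = Fin n ⊎ Bool

  pendantsOf : Fin n → List (Fin n × Bool)
  pendantsOf a = if A a then (a , false) ∷ (a , true) ∷ [] else []

  pendants : List (Fin n × Bool)
  pendants = concatMap pendantsOf (allFin n)

  coronaVerts-split : coronaVerts A ≡ map inj₁ (allFin n) ++ map inj₂ pendants
  coronaVerts-split = cong (map inj₁ (allFin n) ++_)
    (trans (concatMap-cong (λ a → sym (if-float (map inj₂) (A a))) (allFin n))
           (sym (map-concatMap inj₂ pendantsOf (allFin n))))

  count-pendants : ∀ (q : Fin n × Bool → Bool) L →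
    count q (concatMap pendantsOf L)
      ≡ count (λ a → A a ∧ q (a , false)) L + count (λ a → A a ∧ q (a , true)) L
  count-pendants q []      = refl
  count-pendants q (a ∷ L) = begin
    count q (pendantsOf a ++ concatMap pendantsOf L)          ≡⟨ count-++ q (pendantsOf a) _ ⟩
    count q (pendantsOf a) + count q (concatMap pendantsOf L) ≡⟨ cong₂ _+_ own (count-pendants q L) ⟩
    (cf (a ∷ []) + ct (a ∷ [])) + (cf L + ct L)               ≡⟨ shuffle (cf (a ∷ [])) (ct (a ∷ [])) (cf L) (ct L) ⟩
    (cf (a ∷ []) + cf L) + (ct (a ∷ []) + ct L)               ≡⟨ sym (cong₂ _+_ (count-++ (λ a → A a ∧ q (a , false)) (a ∷ []) L) (count-++ (λ a → A a ∧ q (a , true)) (a ∷ []) L)) ⟩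
    cf (a ∷ L) + ct (a ∷ L) ∎
    where
    open ≡-Reasoning
    cf ct : List (Fin n) → ℕ
    cf = count (λ a → A a ∧ q (a , false))
    ct = count (λ a → A a ∧ q (a , true))
    shuffle : ∀ w x y z → (w + x) + (y + z) ≡ (w + y) + (x + z)
    shuffle = solve-∀
    own : count q (pendantsOf a) ≡ cf (a ∷ []) + ct (a ∷ [])
    own rewrite count-singleton (λ a → A a ∧ q (a , false)) a | count-singleton (λ a → A a ∧ q (a , true)) a
      with A a
    ... | false = refl
    ... | true  = trans (count-++ q ((a , false) ∷ []) ((a , true) ∷ []))
                        (cong₂ _+_ (count-singleton q (a , false)) (count-singleton q (a , true)))

  -- The invariant relating the allowed vertices oc of the corona to those op of the sum:
  -- they agree on V(G), and either no vertex of A has been chosen yet (everything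
  -- outside V(G) is free), or exactly one a₀ ∈ A has (both new vertices of the sum and
  -- the pendants of a₀ are blocked; the clique blocks the rest of A, whose pendants stay free).
  data Tracks (oc : Vc → Bool) (op : Vp → Bool) : Set where
    untouched : (∀ v → oc (inj₁ v) ≡ op (inj₁ v)) →
                (∀ b → op (inj₂ b) ≡ true) →
                (∀ a b → A a ≡ true → oc (inj₂ (a , b)) ≡ true) →
                Tracks oc op
    chosen    : (∀ v → oc (inj₁ v) ≡ op (inj₁ v)) →
                (a₀ : Fin n) → A a₀ ≡ true →
                (∀ b → op (inj₂ b) ≡ false) →
                (∀ a → A a ≡ true → a ≢ a₀ → oc (inj₁ a) ≡ false) →
                (∀ a b → A a ≡ true → oc (inj₂ (a , b)) ≡ not (does (a₀ ≟ a))) →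
                Tracks oc op

  tracks-core : ∀ {oc op} → Tracks oc op → ∀ v → oc (inj₁ v) ≡ op (inj₁ v)
  tracks-core (untouched core _ _)     = core
  tracks-core (chosen core _ _ _ _ _) = core

  core-step : ∀ {oc : Vc → Bool} {op : Vp → Bool} → (∀ v → oc (inj₁ v) ≡ op (inj₁ v)) →
    ∀ x v → oc (inj₁ v) ∧ not (Graph.adj G x v) ≡ op (inj₁ v) ∧ not (Graph.adj G x v)
  core-step core x v = cong (_∧ not (Graph.adj G x v)) (core v)

  tracks-step : ∀ {oc op} x → Tracks oc op → oc (inj₁ x) ≡ true →
    Tracks (λ y → oc y ∧ not (coronaAdj G (inj₁ x) y)) (λ y → op y ∧ not (plusAdj G A (inj₁ x) y))
  tracks-step {oc} {op} x t okx with A x in Ax | t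
  ... | false | untouched core free pend = untouched (core-step {oc} {op} core x) free′ pend′
    where
    free′ : ∀ b → op (inj₂ b) ∧ not (A x) ≡ true
    free′ b rewrite free b | Ax = refl
    pend′ : ∀ a b → A a ≡ true → oc (inj₂ (a , b)) ∧ not (does (x ≟ a)) ≡ true
    pend′ a b Aa rewrite pend a b Aa | dec-false (x ≟ a) (λ { refl → contradiction (trans (sym Ax) Aa) λ () }) = refl
  ... | true  | untouched core free pend = chosen (core-step {oc} {op} core x) x Ax closed blocked pend′
    where
    closed : ∀ b → op (inj₂ b) ∧ not (A x) ≡ false
    closed b rewrite Ax = ∧-zeroʳ (op (inj₂ b))
    blocked : ∀ a → A a ≡ true → a ≢ x → oc (inj₁ a) ∧ not (Graph.adj G x a) ≡ false
    blocked a Aa a≢x rewrite clique x a Ax Aa (λ x≡a → a≢x (sym x≡a)) = ∧-zeroʳ (oc (inj₁ a))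
    pend′ : ∀ a b → A a ≡ true → oc (inj₂ (a , b)) ∧ not (does (x ≟ a)) ≡ not (does (x ≟ a))
    pend′ a b Aa rewrite pend a b Aa = refl
  ... | _ | chosen core a₀ Aa₀ closed blocked pend = chosen (core-step {oc} {op} core x) a₀ Aa₀ closed′ blocked′ pend′
    where
    closed′ : ∀ b → op (inj₂ b) ∧ not (A x) ≡ false
    closed′ b rewrite closed b = refl
    blocked′ : ∀ a → A a ≡ true → a ≢ a₀ → oc (inj₁ a) ∧ not (Graph.adj G x a) ≡ false
    blocked′ a Aa a≢a₀ rewrite blocked a Aa a≢a₀ = refl
    pend′ : ∀ a b → A a ≡ true → oc (inj₂ (a , b)) ∧ not (does (x ≟ a)) ≡ not (does (a₀ ≟ a))
    pend′ a b Aa rewrite pend a b Aa with x ≟ a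
    ... | no _     = ∧-identityʳ _
    ... | yes refl with a₀ ≟ x
    ...   | yes _    = refl
    ...   | no a₀≢x  = contradiction (trans (sym okx) (blocked x Aa (λ x≡a₀ → a₀≢x (sym x≡a₀)))) λ ()

  e : ℕ
  e = 2 * card A ∸ 2

  free-pendants : 1 ≤ card A → ∀ {oc op} → Tracks oc op →
    count (λ w → oc (inj₂ w)) pendants ≡ e + count (λ b → op (inj₂ b)) (false ∷ true ∷ [])
  free-pendants h {oc} (untouched core free pend) rewrite free false | free true = begin
    count (λ w → oc (inj₂ w)) pendants                   ≡⟨ count-pendants (λ w → oc (inj₂ w)) (allFin n) ⟩
    count (all-of false) (allFin n) + count (all-of true) (allFin n)
      ≡⟨ cong₂ _+_ (count-cong (all-free false) (allFin n)) (count-cong (all-free true) (allFin n)) ⟩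
    card A + card A                                      ≡⟨ twice-pos (card A) h ⟩
    e + 2 ∎
    where
    open ≡-Reasoning
    all-of : Bool → Fin n → Bool
    all-of b a = A a ∧ oc (inj₂ (a , b))
    all-free : ∀ b a → all-of b a ≡ A a
    all-free b a with A a in Aa
    ... | true  = pend a b Aa
    ... | false = refl
  free-pendants h {oc} (chosen core a₀ Aa₀ closed blocked pend) rewrite closed false | closed true = begin
    count (λ w → oc (inj₂ w)) pendants                   ≡⟨ count-pendants (λ w → oc (inj₂ w)) (allFin n) ⟩
    count (all-of false) (allFin n) + count (all-of true) (allFin n)
      ≡⟨ cong₂ _+_ (count-cong (all-but-a₀ false) (allFin n)) (count-cong (all-but-a₀ true) (allFin n)) ⟩
    c + c                                                ≡⟨ sym (+-identityʳ (c + c)) ⟩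
    (c + c) + 0                                          ≡⟨ cong (_+ 0) (sym (halve c)) ⟩
    (2 * suc c ∸ 2) + 0                                  ≡⟨ cong (λ m → (2 * m ∸ 2) + 0) (sym (count-remove A a₀ Aa₀)) ⟩
    e + 0 ∎
    where
    open ≡-Reasoning
    c : ℕ
    c = count (λ a → not (does (a₀ ≟ a)) ∧ A a) (allFin n)
    all-of : Bool → Fin n → Bool
    all-of b a = A a ∧ oc (inj₂ (a , b))
    all-but-a₀ : ∀ b a → all-of b a ≡ not (does (a₀ ≟ a)) ∧ A a
    all-but-a₀ b a with A a in Aa
    ... | true  = trans (pend a b Aa) (sym (∧-identityʳ _))
    ... | false = sym (∧-zeroʳ _)

  tracks-base : 1 ≤ card A → ∀ {oc op} → Tracks oc op →
    indRec (coronaAdj G) (map inj₂ pendants) oc ≗ mul1+x^ e (indRec (plusAdj G A) (map inj₂ (false ∷ true ∷ [])) op)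
  tracks-base h {oc} {op} t k = begin
    indRec (coronaAdj G) (map inj₂ pendants) oc k  ≡⟨ indRec-independent (coronaAdj G) inj₂ (λ _ _ → refl) pendants oc k ⟩
    mul1+x^ (count (λ w → oc (inj₂ w)) pendants) onePoly k ≡⟨ cong (λ m → mul1+x^ m onePoly k) (free-pendants h t) ⟩
    mul1+x^ (e + c) onePoly k                       ≡⟨ cong (λ p → p k) (mul1+x^-+ e c onePoly) ⟩
    mul1+x^ e (mul1+x^ c onePoly) k
      ≡⟨ mul1+x^-cong e (λ j → sym (indRec-independent (plusAdj G A) inj₂ (λ _ _ → refl) (false ∷ true ∷ []) op j)) k ⟩
    mul1+x^ e (indRec (plusAdj G A) (map inj₂ (false ∷ true ∷ [])) op) k ∎
    where
    open ≡-Reasoning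
    c : ℕ
    c = count (λ b → op (inj₂ b)) (false ∷ true ∷ [])

corollary2 : ∀ {n : ℕ} (G : Graph n) (A : VSet n) → IsClique G A → 1 ≤ card A →
    ∀ (k : ℕ) → Icorona G A k ≡ (onePlusX ^ᵖ (2 * card A ∸ 2) ⊛ Iplus G A) k
corollary2 {n} G A clique h k = begin
  Icorona G A k                                               ≡⟨ indPoly≗indRec (coronaVerts A) (coronaAdj G) k ⟩
  indRec (coronaAdj G) (coronaVerts A) everything k           ≡⟨ cong (λ vs → indRec (coronaAdj G) vs everything k) coronaVerts-split ⟩
  indRec (coronaAdj G) (map inj₁ (allFin n) ++ map inj₂ pendants) everything k ≡⟨ simulate (allFin n) start k ⟩
  mul1+x^ e (indRec (plusAdj G A) (plusVerts {n}) everything) k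
    ≡⟨ mul1+x^-cong e (λ j → sym (indPoly≗indRec (plusVerts {n}) (plusAdj G A) j)) k ⟩
  mul1+x^ e (Iplus G A) k                                     ≡⟨ sym (onePlusX^-⊛ e (Iplus G A) k) ⟩
  (onePlusX ^ᵖ e ⊛ Iplus G A) k ∎
  where
  open ≡-Reasoning
  open CoronaVersusSum G A clique
  open Simulation (coronaAdj G) (plusAdj G A) inj₁ inj₁ (map inj₂ pendants) (map inj₂ (false ∷ true ∷ []))
                  e Tracks tracks-core tracks-step (tracks-base h)
  everything : ∀ {V : Set} → V → Bool
  everything _ = true
  start : Tracks everything everything
  start = untouched (λ _ → refl) (λ _ → refl) (λ _ _ _ → refl)
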